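{- Let $G$ be an undirected graph and let $T$ and $T'$ be inner-maximal rooted subtrees of $G$ such that $root(T)=root(T')$ and $leaves(T)=leaves(T')$. Then $V(T)=V(T')$.
   Context: A rooted subtree of $G$ is a subgraph of $G$ that is a tree, together with a designated vertex $root(T)$. $leaves(T)$ denotes the set of leaves of $T$ (non-root vertices of degree one in $T$); a vertex of $T$ that is not a leaf is called an inner vertex (so the root is an inner vertex). A rooted subtree $T$ of $G$ is inner-maximal if for every inner vertex $v$ of $T$, $N_G(v)\subseteq V(T)$, where $N_G(v)$ is the set of neighbours of $v$ in $G$. -}

module Defs where

open import Level using (0ℓ)
open import Data.Nat using (ℕ; _≥_)
open import Data.Fin using (Fin)
open import Data.List using (List; []; _∷_; length)
open import Data.List.Relation.Unary.Unique.Propositional using (Unique)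
open import Data.Product using (Σ; _×_; ∃)
open import Relation.Nullary using (¬_)
open import Relation.Binary.PropositionalEquality using (_≡_)
open import Function.Bundles using (_⇔_)

record Graph (n : ℕ) : Set₁ where
  field
    Adj    : Fin n → Fin n → Set
    sym    : ∀ {u v} → Adj u v → Adj v u
    irrefl : ∀ {v} → ¬ Adj v v
open Graph public

data Walk {n : ℕ} (E : Fin n → Fin n → Set) : Fin n → Fin n → Set where
  here  : ∀ {v} → Walk E v v
  step  : ∀ {u w v} → E u w → Walk E w v → Walk E u v

data Chain {n : ℕ} (E : Fin n → Fin n → Set) : Fin n → List (Fin n) → Fin n → Set where
  single : ∀ {v} → Chain E v [] v
  cons   : ∀ {u w xs v} → E u w → Chain E w xs v → Chain E u (w ∷ xs) v

Cycle : ∀ {n} → (Fin n → Fin n → Set) → Set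
Cycle {n} E = Σ (Fin n) λ v₀ → Σ (List (Fin n)) λ xs → Σ (Fin n) λ vₖ →
  Chain E v₀ xs vₖ × Unique (v₀ ∷ xs) × length xs ≥ 2 × E vₖ v₀

record RootedSubtree {n : ℕ} (G : Graph n) : Set₁ where
  field
    Vert      : Fin n → Set
    Edge      : Fin n → Fin n → Set
    root      : Fin n
    root∈     : Vert root
    edge⊆G    : ∀ {u v} → Edge u v → Adj G u v
    edge-sym  : ∀ {u v} → Edge u v → Edge v u
    edge-ends : ∀ {u v} → Edge u v → Vert u × Vert v
    connected : ∀ {u v} → Vert u → Vert v → Walk Edge u v
    acyclic   : ¬ Cycle Edge
open RootedSubtree public

DegreeOne : ∀ {n} {G : Graph n} → RootedSubtree G → Fin n → Set
DegreeOne T v = ∃ λ u → Edge T v u × (∀ w → Edge T v w → w ≡ u)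

IsLeaf : ∀ {n} {G : Graph n} → RootedSubtree G → Fin n → Set
IsLeaf T v = Vert T v × ¬ (v ≡ root T) × DegreeOne T v

IsInner : ∀ {n} {G : Graph n} → RootedSubtree G → Fin n → Set
IsInner T v = Vert T v × ¬ IsLeaf T v

InnerMaximal : ∀ {n} {G : Graph n} → RootedSubtree G → Set
InnerMaximal {G = G} T = ∀ v → IsInner T v → ∀ u → Adj G v u → Vert T u

SameSet : ∀ {n} → (Fin n → Set) → (Fin n → Set) → Set
SameSet P Q = ∀ v → P v ⇔ Q v

{-# OPTIONS --safe #-}
-- Take a walk in T from the root to v and cancel its backtracking steps.  Every
-- vertex strictly inside the resulting walk has two distinct T-neighbours, so it
-- is not a leaf of T, hence not a leaf of T′; the root is not a leaf of T′
-- either.  Hence each vertex of the walk that lies in T′ is an inner vertex of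
-- T′, and inner-maximality of T′ puts the next vertex in T′ too.
module Submission where

open import Defs hiding (sym)
open import Data.Nat using (ℕ)
open import Data.Fin using (Fin; _≟_)
open import Data.Maybe using (Maybe; just; nothing)
open import Data.Maybe.Properties using (just-injective)
open import Data.Product using (_,_; proj₁; proj₂; _×_; ∃₂)
open import Function using (_∘_)
open import Function.Bundles using (mk⇔; Equivalence)
open import Relation.Binary.Definitions using (Symmetric)
open import Relation.Binary.PropositionalEquality using (_≡_; _≢_; refl; sym; trans; cong; subst)
open import Relation.Nullary using (¬_; yes; no)

module _ {n : ℕ} (E : Fin n → Fin n → Set) where

  -- NonBacktracking E p u v: a walk from u to v whose first step does not go
  -- back to p, the vertex it was entered from (nothing: no such vertex).
  data NonBacktracking : Maybe (Fin n) → Fin n → Fin n → Set where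
    here : ∀ {p v} → NonBacktracking p v v
    step : ∀ {p u w v} → E u w → NonBacktracking (just u) w v → p ≢ just w →
           NonBacktracking p u v

  forget-entry : ∀ {p u v} → NonBacktracking p u v → NonBacktracking nothing u v
  forget-entry here         = here
  forget-entry (step e w _) = step e w λ ()

  prepend : ∀ {u w v} → E u w → NonBacktracking nothing w v → NonBacktracking nothing u v
  prepend e here = step e here λ ()
  prepend {u} e (step {w = x} e′ w _) with x ≟ u
  ... | yes refl = forget-entry w
  ... | no x≢u   = step e (step e′ w (x≢u ∘ sym ∘ just-injective)) λ ()

  remove-backtracking : ∀ {u v} → Walk E u v → NonBacktracking nothing u v
  remove-backtracking here       = here
  remove-backtracking (step e w) = prepend e (remove-backtracking w)

  Branching : Fin n → Set
  Branching x = ∃₂ λ a b → E x a × E x b × a ≢ b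

module _ {n : ℕ} {E : Fin n → Fin n → Set} (E-sym : Symmetric E)
         (S Open : Fin n → Set)
         (spread : ∀ {x y} → Open x → E x y → S y)
         (branching⇒open : ∀ {x} → S x → Branching E x → Open x) where

  private
    -- A later vertex of the walk has an edge back to where it was entered
    -- from; together with the next, distinct step this makes it Branching.
    Entered : Maybe (Fin n) → Fin n → Set
    Entered nothing  u = Open u
    Entered (just p) u = E u p

    along : ∀ {p u v} → NonBacktracking E p u v → S u → Entered p u → S v
    along here                    Su _      = Su
    along (step {nothing} e w _)  _  Open-u = along w (spread Open-u e) (E-sym e)
    along (step {just p} e w p≢w) Su Eup    =
      along w (spread (branching⇒open Su (p , _ , Eup , e , p≢w ∘ cong just)) e) (E-sym e)

  closed-under-walks : ∀ {s v} → S s → Open s → Walk E s v → S v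
  closed-under-walks Ss Open-s w = along (remove-backtracking E w) Ss Open-s

module _ {n : ℕ} {G : Graph n} where

  branching⇒¬degreeOne : ∀ (T : RootedSubtree G) {x} → Branching (Edge T) x → ¬ DegreeOne T x
  branching⇒¬degreeOne T (a , b , Exa , Exb , a≢b) (_ , _ , unique) =
    a≢b (trans (unique a Exa) (sym (unique b Exb)))

  root-inner : ∀ (T : RootedSubtree G) → IsInner T (root T)
  root-inner T = root∈ T , λ (_ , root≢root , _) → root≢root refl

  vert⊆vert : ∀ (T T′ : RootedSubtree G) → InnerMaximal T′ → root T ≡ root T′ →
              (∀ x → IsLeaf T′ x → IsLeaf T x) → ∀ {v} → Vert T v → Vert T′ v
  vert⊆vert T T′ IM′ root≡ leaf⊆ Tv =
    closed-under-walks (edge-sym T) (Vert T′) (IsInner T′)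
      (λ {x} inner e → IM′ x inner _ (edge⊆G T e))
      (λ {x} T′x br → T′x , λ leaf′ → branching⇒¬degreeOne T br (proj₂ (proj₂ (leaf⊆ x leaf′))))
      (proj₁ inner-root) inner-root
      (connected T (root∈ T) Tv)
    where
      inner-root : IsInner T′ (root T)
      inner-root = subst (IsInner T′) (sym root≡) (root-inner T′)

lemma5 : ∀ {n} (G : Graph n) (T T′ : RootedSubtree G)
    → InnerMaximal T → InnerMaximal T′
    → root T ≡ root T′
    → SameSet (IsLeaf T) (IsLeaf T′)
    → SameSet (Vert T) (Vert T′)
lemma5 G T T′ IM IM′ root≡ same-leaves v =
  mk⇔ (vert⊆vert T T′ IM′ root≡ (Equivalence.from ∘ same-leaves))
      (vert⊆vert T′ T IM (sym root≡) (Equivalence.to ∘ same-leaves))
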